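{- Let $\delta$ be a formula of the language of interpretability logic, with associated set $\Gamma^*$ as described in the context. Let $\Delta\subseteq\Gamma^*$ be a maximal Boolean consistent set (w.r.t. $\Gamma^*$), let $\Gamma^{i}$ be the set of all formulas in $\Gamma^*$ of the form $\varphi\rhd\psi$, and put $\Delta^+=\Delta\cap\Gamma^{i}$ and $\Delta^-=\{\varphi:\neg\varphi\in\Delta\}\cap\Gamma^{i}$. The following are equivalent: (1) there exists a rooted Veltman model of $\Delta$; (2) for every $\zeta\in\Delta^-$ there is a rooted Veltman model $(\mathcal{H}_\zeta,h_\zeta)$ of $\Delta^+$ such that $\mathcal{H}_\zeta,h_\zeta\nVdash\zeta$.
   Context: Formulas: $A::=p\mid\bot\mid A\to A\mid A\rhd A$, with $p$ ranging over propositional variables; other Boolean connectives are abbreviations, $\Box A$ abbreviates $\neg A\rhd\bot$ and $\Diamond A$ abbreviates $\neg(A\rhd\bot)$. A Veltman frame is a triple $(W,R,\{S_x:x\in W\})$ where $W\neq\emptyset$, $R$ is a transitive and reverse well-founded relation on $W$, and for each $x\in W$: (a) if $uS_xv$ then $xRu$ and $xRv$; (b) $S_x$ is reflexive and transitive on $\{y\in W: xRy\}$; (c) if $xRuRv$ then $uS_xv$. A Veltman model adds a forcing relation $\Vdash$, defined as usual for variables and Boolean connectives, with $x\Vdash A\rhd B$ iff for all $u$ with $xRu$ and $u\Vdash A$ there is $v$ with $uS_xv$ and $v\Vdash B$. A rooted Veltman model $(\mathfrak{M},w)$ is a Veltman model together with a world $w$ such that every other world is $R$-accessible from $w$; it is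 a model of a set of formulas $\Phi$ if $\mathfrak{M},w\Vdash\varphi$ for every $\varphi\in\Phi$. Given $\delta$, let $Sub(\delta)$ be its set of subformulas; $\Gamma^{\rhd}=\{\varphi: \text{for some }\psi,\ \varphi\rhd\psi\in Sub(\delta)\text{ or }\psi\rhd\varphi\in Sub(\delta)\}$; $\Gamma=Sub(\delta)\cup\{\bot\}\cup\{\varphi\rhd\bot:\varphi\in\Gamma^{\rhd}\}$; $\Gamma^*=\Gamma\cup\{\neg\varphi:\varphi\in\Gamma\}$. A set $S$ of formulas is propositionally consistent if the set of propositional formulas obtained by uniformly replacing every subformula of the form $C\rhd D$ by a fresh propositional variable is classically consistent. A set $S\subseteq T$ is maximal Boolean consistent (w.r.t. $T$) if $S$ is propositionally consistent and there is no propositionally consistent $S'\subseteq T$ with $S\subsetneq S'$. -}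

module Defs where

open import Level using (0ℓ)
open import Data.Nat using (ℕ)
open import Data.Bool using (Bool; true; false; not; _∨_)
open import Data.Empty using (⊥)
open import Data.Product using (Σ; _×_; _,_)
open import Data.Sum using (_⊎_)
open import Relation.Nullary using (¬_)
open import Relation.Binary.PropositionalEquality using (_≡_; _≢_)
open import Induction.WellFounded using (WellFounded)

infixr 6 _⇒_
infix 7 _▷_

data Fm : Set where
  var : ℕ → Fm
  ⊥' : Fm
  _⇒_ : Fm → Fm → Fm
  _▷_ : Fm → Fm → Fm

~_ : Fm → Fm
~ A = A ⇒ ⊥'

FmSet : Set₁
FmSet = Fm → Set

_⊆_ : FmSet → FmSet → Set
S ⊆ T = ∀ φ → S φ → T φ

data _∈Sub_ : Fm → Fm → Set where
  sub-refl : ∀ {φ} → φ ∈Sub φ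
  sub-⇒ˡ : ∀ {φ A B} → φ ∈Sub A → φ ∈Sub (A ⇒ B)
  sub-⇒ʳ : ∀ {φ A B} → φ ∈Sub B → φ ∈Sub (A ⇒ B)
  sub-▷ˡ : ∀ {φ A B} → φ ∈Sub A → φ ∈Sub (A ▷ B)
  sub-▷ʳ : ∀ {φ A B} → φ ∈Sub B → φ ∈Sub (A ▷ B)

Γ▷ : Fm → FmSet
Γ▷ δ φ = Σ Fm (λ ψ → ((φ ▷ ψ) ∈Sub δ) ⊎ ((ψ ▷ φ) ∈Sub δ))

Γ : Fm → FmSet
Γ δ φ = (φ ∈Sub δ) ⊎ (φ ≡ ⊥') ⊎ Σ Fm (λ χ → Γ▷ δ χ × (φ ≡ (χ ▷ ⊥')))

Γ* : Fm → FmSet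
Γ* δ φ = Γ δ φ ⊎ Σ Fm (λ χ → Γ δ χ × (φ ≡ ~ χ))

-- Replacing each ▷-formula uniformly by a fresh variable and evaluating
-- classically amounts to a Boolean valuation of the variables together
-- with an arbitrary Boolean value for every ▷-formula.

evalP : (ℕ → Bool) → (Fm → Bool) → Fm → Bool
evalP v u (var p) = v p
evalP v u ⊥' = false
evalP v u (A ⇒ B) = not (evalP v u A) ∨ evalP v u B
evalP v u (A ▷ B) = u (A ▷ B)

PropConsistent : FmSet → Set
PropConsistent S =
  Σ (ℕ → Bool) (λ v → Σ (Fm → Bool) (λ u → ∀ φ → S φ → evalP v u φ ≡ true))

MaxBoolCons : FmSet → FmSet → Set₁
MaxBoolCons T S =
  (S ⊆ T) × PropConsistent S ×
  (∀ (S' : FmSet) → S' ⊆ T → PropConsistent S' → S ⊆ S' →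
     ¬ Σ Fm (λ φ → S' φ × ¬ S φ))

IsRhd : Fm → Set
IsRhd φ = Σ Fm (λ A → Σ Fm (λ B → φ ≡ (A ▷ B)))

Γi : Fm → FmSet
Γi δ φ = Γ* δ φ × IsRhd φ

Δ⁺ : Fm → FmSet → FmSet
Δ⁺ δ Δ φ = Δ φ × Γi δ φ

Δ⁻ : Fm → FmSet → FmSet
Δ⁻ δ Δ φ = Δ (~ φ) × Γi δ φ

record VeltmanModel : Set₁ where
  field
    W : Set
    R : W → W → Set
    S : W → W → W → Set          -- S x u v  means  u S_x v
    V : W → ℕ → Set
    R-trans : ∀ {x y z} → R x y → R y z → R x z
    R-rwf : WellFounded (λ x y → R y x)
    S-R : ∀ {x u v} → S x u v → R x u × R x v
    S-refl : ∀ {x u} → R x u → S x u u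
    S-trans : ∀ {x u v t} → S x u v → S x v t → S x u t
    R⊆S : ∀ {x u v} → R x u → R u v → S x u v

module _ (M : VeltmanModel) where
  open VeltmanModel M

  _⊩_ : W → Fm → Set
  x ⊩ var p = V x p
  x ⊩ ⊥' = ⊥
  x ⊩ (A ⇒ B) = x ⊩ A → x ⊩ B
  x ⊩ (A ▷ B) = ∀ u → R x u → u ⊩ A → Σ W (λ v → S x u v × v ⊩ B)

record RootedModel : Set₁ where
  field
    model : VeltmanModel
    root : VeltmanModel.W model
    rooted : ∀ x → x ≢ root → VeltmanModel.R model root x

_⊨_ : RootedModel → FmSet → Set
H ⊨ Φ = ∀ φ → Φ φ → _⊩_ (RootedModel.model H) (RootedModel.root H) φ

_⊮_ : RootedModel → Fm → Set
H ⊮ φ = ¬ _⊩_ (RootedModel.model H) (RootedModel.root H) φ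

-- Given the countermodels (H_ζ, h_ζ), put them side by side below a fresh root r whose
-- variables follow a Boolean valuation (v, u) of Δ.  The generated submodels are unchanged,
-- and r forces A ▷ B exactly when every h_ζ does, since S_r only links worlds of the same
-- component.  So r forces Δ⁺ and refutes Δ⁻; by maximality of Δ this says that r agrees
-- with u on the ▷-formulas of Γ*, hence with (v, u) on all of Γ* ⊇ Δ.
module Submission where

open import Defs
open import Level using (0ℓ)
open import Axiom.ExcludedMiddle using (ExcludedMiddle)
open import Data.Nat using (ℕ)
open import Data.Bool using (Bool; true; false; not; _∨_)
open import Data.Bool.Properties using () renaming (_≟_ to _≟ᵇ_)
open import Data.Empty using (⊥-elim)
open import Data.Product using (Σ; _×_; _,_; proj₁; proj₂)
open import Data.Sum using (inj₁; inj₂)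
open import Function using (_∘_)
open import Function.Bundles using (_⇔_; mk⇔; Equivalence)
open import Induction.WellFounded using (WellFounded; Acc; acc)
open import Relation.Nullary.Decidable.Core using (decidable-stable)
open import Relation.Binary.PropositionalEquality using (_≡_; _≢_; refl)

open Equivalence using (to; from)

∈Sub-trans : ∀ {A B C} → A ∈Sub B → B ∈Sub C → A ∈Sub C
∈Sub-trans p sub-refl   = p
∈Sub-trans p (sub-⇒ˡ q) = sub-⇒ˡ (∈Sub-trans p q)
∈Sub-trans p (sub-⇒ʳ q) = sub-⇒ʳ (∈Sub-trans p q)
∈Sub-trans p (sub-▷ˡ q) = sub-▷ˡ (∈Sub-trans p q)
∈Sub-trans p (sub-▷ʳ q) = sub-▷ʳ (∈Sub-trans p q)

Γ*-⇒ : ∀ {δ A B} → Γ* δ (A ⇒ B) → Γ* δ A × Γ* δ B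
Γ*-⇒ (inj₁ (inj₁ s)) =
  inj₁ (inj₁ (∈Sub-trans (sub-⇒ˡ sub-refl) s)) , inj₁ (inj₁ (∈Sub-trans (sub-⇒ʳ sub-refl) s))
Γ*-⇒ (inj₁ (inj₂ (inj₁ ())))
Γ*-⇒ (inj₁ (inj₂ (inj₂ (_ , _ , ()))))
Γ*-⇒ (inj₂ (_ , g , refl)) = inj₁ g , inj₁ (inj₂ (inj₁ refl))

Γ*-▷⇒Γ*-~ : ∀ {δ A B} → Γ* δ (A ▷ B) → Γ* δ (~ (A ▷ B))
Γ*-▷⇒Γ*-~ {A = A} {B} (inj₁ g) = inj₂ (A ▷ B , g , refl)
Γ*-▷⇒Γ*-~ (inj₂ (_ , _ , ()))

not-∨-≡true⇔ : ∀ a b → (not a ∨ b ≡ true) ⇔ (a ≡ true → b ≡ true)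
not-∨-≡true⇔ false b = mk⇔ (λ _ ()) (λ _ → refl)
not-∨-≡true⇔ true  b = mk⇔ (λ e _ → e) (λ f → f refl)

maxBoolCons-complete : ExcludedMiddle 0ℓ → ∀ {T Δ} → MaxBoolCons T Δ →
  ∀ {v u} → (∀ φ → Δ φ → evalP v u φ ≡ true) →
  ∀ {φ} → T φ → evalP v u φ ≡ true → Δ φ
maxBoolCons-complete em {T} (Δ⊆T , _ , maximal) {v} {u} v,u⊨Δ {φ} φ∈T φ-true =
  decidable-stable em λ φ∉Δ →
    maximal satisfied (λ _ → proj₁) (v , u , λ _ → proj₂)
            (λ ψ ψ∈Δ → Δ⊆T ψ ψ∈Δ , v,u⊨Δ ψ ψ∈Δ) (φ , (φ∈T , φ-true) , φ∉Δ)
  where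
  satisfied : FmSet
  satisfied ψ = T ψ × evalP v u ψ ≡ true

truth-lemma : (M : VeltmanModel) (x : VeltmanModel.W M) (v : ℕ → Bool) (u : Fm → Bool)
  (T : FmSet) → (∀ {A B} → T (A ⇒ B) → T A × T B) →
  (∀ p → _⊩_ M x (var p) ⇔ (v p ≡ true)) →
  (∀ {A B} → T (A ▷ B) → _⊩_ M x (A ▷ B) ⇔ (u (A ▷ B) ≡ true)) →
  ∀ φ → T φ → _⊩_ M x φ ⇔ (evalP v u φ ≡ true)
truth-lemma M x v u T T-⇒ agree-var agree-▷ = go
  where
  go : ∀ φ → T φ → _⊩_ M x φ ⇔ (evalP v u φ ≡ true)
  go (var p) _ = agree-var p
  go ⊥' _ = mk⇔ (λ ()) (λ ())
  go (A ▷ B) t = agree-▷ t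
  go (A ⇒ B) t = mk⇔
    (λ f → from imp (to IB ∘ f ∘ from IA))
    (λ e → from IB ∘ to imp e ∘ to IA)
    where
    imp = not-∨-≡true⇔ (evalP v u A) (evalP v u B)
    IA = go A (proj₁ (T-⇒ t))
    IB = go B (proj₂ (T-⇒ t))

-- Each component contributes only the worlds strictly above its root: the fresh root
-- plays the part of every component root at once.
module RootedSum {I : Set} (family : I → RootedModel) (V₀ : ℕ → Set) where

  module F (i : I) where
    open RootedModel (family i) public
    open VeltmanModel model public

  forces : (i : I) → F.W i → Fm → Set
  forces i = _⊩_ (F.model i)

  syntax forces i x φ = x ⊩[ i ] φ

  data World : Set where
    root : World
    inn  : (i : I) (x : F.W i) → F.R i (F.root i) x → World

  data R : World → World → Set where
    R-root : ∀ i x r → R root (inn i x r)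
    R-inn  : ∀ i {x y} r₁ r₂ → F.R i x y → R (inn i x r₁) (inn i y r₂)

  data S : World → World → World → Set where
    S-root : ∀ i {y z} r₂ r₃ → F.S i (F.root i) y z → S root (inn i y r₂) (inn i z r₃)
    S-inn  : ∀ i {x y z} r₁ r₂ r₃ → F.S i x y z → S (inn i x r₁) (inn i y r₂) (inn i z r₃)

  V : World → ℕ → Set
  V root        = V₀
  V (inn i x _) = F.V i x

  R-trans : ∀ {x y z} → R x y → R y z → R x z
  R-trans (R-root i _ r)    (R-inn .i .r r₂ _)   = R-root i _ r₂
  R-trans (R-inn i r₁ r₂ a) (R-inn .i .r₂ r₃ b) = R-inn i r₁ r₃ (F.R-trans i a b)

  acc-inn : ∀ i x → Acc (λ a b → F.R i b a) x → ∀ r → Acc (λ a b → R b a) (inn i x r)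
  acc-inn i x (acc rs) r = acc λ { (R-inn .i .r r₂ xy) → acc-inn i _ (rs xy) r₂ }

  R-rwf : WellFounded (λ a b → R b a)
  R-rwf root        = acc λ { (R-root i x r) → acc-inn i x (F.R-rwf i x) r }
  R-rwf (inn i x r) = acc-inn i x (F.R-rwf i x) r

  S-R : ∀ {x y z} → S x y z → R x y × R x z
  S-R (S-root i r₂ r₃ _)    = R-root i _ r₂ , R-root i _ r₃
  S-R (S-inn i r₁ r₂ r₃ s) = R-inn i r₁ r₂ (proj₁ (F.S-R i s)) , R-inn i r₁ r₃ (proj₂ (F.S-R i s))

  S-refl : ∀ {x y} → R x y → S x y y
  S-refl (R-root i _ r)    = S-root i r r (F.S-refl i r)
  S-refl (R-inn i r₁ r₂ a) = S-inn i r₁ r₂ r₂ (F.S-refl i a)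

  S-trans : ∀ {x y z t} → S x y z → S x z t → S x y t
  S-trans (S-root i r₂ r₃ a)    (S-root .i .r₃ r₄ b)      = S-root i r₂ r₄ (F.S-trans i a b)
  S-trans (S-inn i r₁ r₂ r₃ a) (S-inn .i .r₁ .r₃ r₄ b) = S-inn i r₁ r₂ r₄ (F.S-trans i a b)

  R⊆S : ∀ {x y z} → R x y → R y z → S x y z
  R⊆S (R-root i _ r)    (R-inn .i .r r₂ b)   = S-root i r r₂ (F.R⊆S i r b)
  R⊆S (R-inn i r₁ r₂ a) (R-inn .i .r₂ r₃ b) = S-inn i r₁ r₂ r₃ (F.R⊆S i a b)

  model : VeltmanModel
  model = record
    { W = World ; R = R ; S = S ; V = V
    ; R-trans = R-trans ; R-rwf = R-rwf ; S-R = S-R ; S-refl = S-refl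
    ; S-trans = S-trans ; R⊆S = R⊆S }

  rooted : ∀ x → x ≢ root → R root x
  rooted root        root≢root = ⊥-elim (root≢root refl)
  rooted (inn i x r) _         = R-root i x r

  rootedModel : RootedModel
  rootedModel = record { model = model ; root = root ; rooted = rooted }

  _⊩ₛ_ : World → Fm → Set
  _⊩ₛ_ = _⊩_ model

  ⊩-inn⇒ : ∀ i x r φ → inn i x r ⊩ₛ φ → x ⊩[ i ] φ
  ⊩-inn⇐ : ∀ i x r φ → x ⊩[ i ] φ → inn i x r ⊩ₛ φ
  ⊩-inn⇒ i x r (var p) f = f
  ⊩-inn⇒ i x r ⊥' f = f
  ⊩-inn⇒ i x r (A ⇒ B) f = ⊩-inn⇒ i x r B ∘ f ∘ ⊩-inn⇐ i x r A
  ⊩-inn⇒ i x r (A ▷ B) f y xy yA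
    with f (inn i y (F.R-trans i r xy)) (R-inn i r _ xy) (⊩-inn⇐ i y _ A yA)
  ... | .(inn i _ r₃) , S-inn .i .r _ r₃ s , zB = _ , s , ⊩-inn⇒ i _ r₃ B zB
  ⊩-inn⇐ i x r (var p) f = f
  ⊩-inn⇐ i x r ⊥' f = f
  ⊩-inn⇐ i x r (A ⇒ B) f = ⊩-inn⇐ i x r B ∘ f ∘ ⊩-inn⇒ i x r A
  ⊩-inn⇐ i x r (A ▷ B) f .(inn i y r₂) (R-inn .i {y = y} .r r₂ xy) yA
    with f y xy (⊩-inn⇒ i y r₂ A yA)
  ... | z , s , zB = inn i z r₃ , S-inn i r r₂ r₃ s , ⊩-inn⇐ i z r₃ B zB
    where r₃ = F.R-trans i r (proj₂ (F.S-R i s))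

  root⊩▷⇔ : ∀ A B → root ⊩ₛ (A ▷ B) ⇔ (∀ i → F.root i ⊩[ i ] (A ▷ B))
  root⊩▷⇔ A B = mk⇔ restrict combine
    where
    restrict : root ⊩ₛ (A ▷ B) → ∀ i → F.root i ⊩[ i ] (A ▷ B)
    restrict f i x r xA with f (inn i x r) (R-root i x r) (⊩-inn⇐ i x r A xA)
    ... | .(inn i _ r₃) , S-root .i .r r₃ s , zB = _ , s , ⊩-inn⇒ i _ r₃ B zB
    combine : (∀ i → F.root i ⊩[ i ] (A ▷ B)) → root ⊩ₛ (A ▷ B)
    combine f .(inn i x r) (R-root i x r) xA with f i x r (⊩-inn⇒ i x r A xA)
    ... | z , s , zB = inn i z r₃ , S-root i r r₃ s , ⊩-inn⇐ i z r₃ B zB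
      where r₃ = proj₂ (F.S-R i s)

Countermodels : Fm → FmSet → Set₁
Countermodels δ Δ = ∀ ζ → Δ⁻ δ Δ ζ → Σ RootedModel (λ H → (H ⊨ Δ⁺ δ Δ) × (H ⊮ ζ))

countermodels⇒model : ExcludedMiddle 0ℓ → ∀ δ Δ → MaxBoolCons (Γ* δ) Δ →
  Countermodels δ Δ → Σ RootedModel (λ H → H ⊨ Δ)
countermodels⇒model em δ Δ maxΔ@(Δ⊆Γ* , (v , u , v,u⊨Δ) , _) hyp =
  rootedModel , λ φ φ∈Δ → from (root-truth φ (Δ⊆Γ* φ φ∈Δ)) (v,u⊨Δ φ φ∈Δ)
  where
  family : Σ Fm (Δ⁻ δ Δ) → RootedModel
  family (ζ , ζ∈Δ⁻) = proj₁ (hyp ζ ζ∈Δ⁻)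

  open RootedSum family (λ p → v p ≡ true)

  complete : ∀ {φ} → Γ* δ φ → evalP v u φ ≡ true → Δ φ
  complete = maxBoolCons-complete em maxΔ v,u⊨Δ

  root-agrees-▷ : ∀ {A B} → Γ* δ (A ▷ B) → root ⊩ₛ (A ▷ B) ⇔ (u (A ▷ B) ≡ true)
  root-agrees-▷ {A} {B} t = mk⇔ forced⇒true true⇒forced
    where
    A▷B∈Γi : Γi δ (A ▷ B)
    A▷B∈Γi = t , A , B , refl

    true⇒forced : u (A ▷ B) ≡ true → root ⊩ₛ (A ▷ B)
    true⇒forced e = from (root⊩▷⇔ A B) λ { (ζ , ζ∈Δ⁻) →
      proj₁ (proj₂ (hyp ζ ζ∈Δ⁻)) (A ▷ B) (complete t e , A▷B∈Γi) }

    false⇒~A▷B∈Δ : u (A ▷ B) ≢ true → Δ (~ (A ▷ B))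
    false⇒~A▷B∈Δ u≢true =
      complete (Γ*-▷⇒Γ*-~ t) (from (not-∨-≡true⇔ _ false) (⊥-elim ∘ u≢true))

    forced⇒true : root ⊩ₛ (A ▷ B) → u (A ▷ B) ≡ true
    forced⇒true f = decidable-stable (u (A ▷ B) ≟ᵇ true) λ u≢true →
      let i = A ▷ B , false⇒~A▷B∈Δ u≢true , A▷B∈Γi
      in proj₂ (proj₂ (hyp (A ▷ B) (proj₂ i))) (to (root⊩▷⇔ A B) f i)

  root-truth : ∀ φ → Γ* δ φ → root ⊩ₛ φ ⇔ (evalP v u φ ≡ true)
  root-truth = truth-lemma model root v u (Γ* δ) Γ*-⇒ (λ _ → mk⇔ (λ e → e) (λ e → e)) root-agrees-▷

lemma2 : ExcludedMiddle 0ℓ → (δ : Fm) (Δ : FmSet) → MaxBoolCons (Γ* δ) Δ →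
    (Σ RootedModel (λ H → H ⊨ Δ))
      ⇔ (∀ ζ → Δ⁻ δ Δ ζ → Σ RootedModel (λ H → (H ⊨ Δ⁺ δ Δ) × (H ⊮ ζ)))
lemma2 em δ Δ maxΔ = mk⇔ model⇒countermodels (countermodels⇒model em δ Δ maxΔ)
  where
  model⇒countermodels : Σ RootedModel (λ H → H ⊨ Δ) → Countermodels δ Δ
  model⇒countermodels (H , H⊨Δ) ζ (~ζ∈Δ , _) = H , (λ φ → H⊨Δ φ ∘ proj₁) , H⊨Δ (~ ζ) ~ζ∈Δ
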